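{- Let $G$ be a vertex-transitive graph without isolated vertices and $\ell$ a nonnegative integer. Then $\gamma_{\mathrm{pr}}(G^{\,\cdot \ell})\ge \gamma_{\mathrm{pr}}(G)$.
   Context: All graphs are finite and simple. For a vertex-transitive graph $G$ and a positive integer $\ell$, $G^{\,\cdot\ell}$ denotes the graph obtained from $G$ by taking a disjoint path on $\ell$ vertices and adding one edge (a bridge) joining an endpoint (degree-1 vertex) of the path to a vertex of $G$ (well defined up to isomorphism by vertex-transitivity); $G^{\,\cdot 0}=G$. A set $D$ is dominating if every vertex is in $D$ or adjacent to a vertex of $D$. For a graph without isolated vertices, $\gamma_{\mathrm{pr}}$ is the minimum size of a dominating set whose induced subgraph has a perfect matching. -}

module Defs where

open import Data.Nat using (ℕ; zero; suc; _+_; _≤_; _≡ᵇ_)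
open import Data.Fin using (Fin; toℕ; splitAt; _≟_)
open import Data.Fin.Subset using (Subset; _∈_; ∣_∣)
open import Data.Bool using (Bool; true; false; _∧_; _∨_; T)
open import Data.Bool.Properties using (∨-comm)
open import Data.Sum using (_⊎_; inj₁; inj₂)
open import Data.Product using (Σ; ∃; _×_; _,_)
open import Function.Bundles using (_↔_; Inverse)
open import Relation.Nullary.Decidable using (⌊_⌋)
open import Relation.Binary.PropositionalEquality using (_≡_; refl; sym; cong)

record Graph : Set where
  field
    n       : ℕ
    Adj     : Fin n → Fin n → Bool
    symm    : ∀ x y → Adj x y ≡ Adj y x
    irrefl  : ∀ x → Adj x x ≡ false
open Graph public

NoIsolated : Graph → Set
NoIsolated G = ∀ x → ∃ λ y → Adj G x y ≡ true

IsAutomorphism : (G : Graph) → (Fin (n G) ↔ Fin (n G)) → Set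
IsAutomorphism G σ = ∀ x y → Adj G (Inverse.to σ x) (Inverse.to σ y) ≡ Adj G x y

VertexTransitive : Graph → Set
VertexTransitive G = ∀ u v → Σ (Fin (n G) ↔ Fin (n G)) λ σ →
  IsAutomorphism G σ × Inverse.to σ u ≡ v

Dominating : (G : Graph) → Subset (n G) → Set
Dominating G D = ∀ x → x ∈ D ⊎ ∃ λ y → y ∈ D × Adj G x y ≡ true

-- The induced subgraph G[D] has a perfect matching: an involution p on D
-- pairing every vertex of D with a neighbour in D.
InducedPerfectMatching : (G : Graph) → Subset (n G) → Set
InducedPerfectMatching G D = Σ (Fin (n G) → Fin (n G)) λ p →
  ∀ x → x ∈ D → (p x ∈ D) × (Adj G x (p x) ≡ true) × (p (p x) ≡ x)

PairedDominating : (G : Graph) → Subset (n G) → Set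
PairedDominating G D = Dominating G D × InducedPerfectMatching G D

IsPairedDomNumber : Graph → ℕ → Set
IsPairedDomNumber G k =
  (Σ (Subset (n G)) λ D → PairedDominating G D × ∣ D ∣ ≡ k) ×
  (∀ D → PairedDominating G D → k ≤ ∣ D ∣)

-- G^{·ℓ}: attach a path on ℓ vertices (vertices n, …, n+ℓ-1, in order)
-- to vertex v of G by a bridge from v to the path endpoint n (path index 0).
private
  adjS : (G : Graph) (ℓ : ℕ) (v : Fin (n G)) →
         Fin (n G) ⊎ Fin ℓ → Fin (n G) ⊎ Fin ℓ → Bool
  adjS G ℓ v (inj₁ a) (inj₁ b) = Adj G a b
  adjS G ℓ v (inj₁ a) (inj₂ i) = ⌊ a ≟ v ⌋ ∧ (toℕ i ≡ᵇ 0)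
  adjS G ℓ v (inj₂ i) (inj₁ a) = ⌊ a ≟ v ⌋ ∧ (toℕ i ≡ᵇ 0)
  adjS G ℓ v (inj₂ i) (inj₂ j) = (suc (toℕ i) ≡ᵇ toℕ j) ∨ (suc (toℕ j) ≡ᵇ toℕ i)

  adjS-sym : ∀ G ℓ v x y → adjS G ℓ v x y ≡ adjS G ℓ v y x
  adjS-sym G ℓ v (inj₁ a) (inj₁ b) = symm G a b
  adjS-sym G ℓ v (inj₁ a) (inj₂ i) = refl
  adjS-sym G ℓ v (inj₂ i) (inj₁ a) = refl
  adjS-sym G ℓ v (inj₂ i) (inj₂ j) =
    ∨-comm (suc (toℕ i) ≡ᵇ toℕ j) (suc (toℕ j) ≡ᵇ toℕ i)

  sucᵇ : ∀ k → (suc k ≡ᵇ k) ≡ false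
  sucᵇ zero = refl
  sucᵇ (suc k) = sucᵇ k

  adjS-irr : ∀ G ℓ v x → adjS G ℓ v x x ≡ false
  adjS-irr G ℓ v (inj₁ a) = irrefl G a
  adjS-irr G ℓ v (inj₂ i) rewrite sucᵇ (toℕ i) = refl

attachPath : (G : Graph) → ℕ → Fin (n G) → Graph
attachPath G ℓ v = record
  { n      = n G + ℓ
  ; Adj    = λ x y → adjS G ℓ v (splitAt (n G) x) (splitAt (n G) y)
  ; symm   = λ x y → adjS-sym G ℓ v (splitAt (n G) x) (splitAt (n G) y)
  ; irrefl = λ x → adjS-irr G ℓ v (splitAt (n G) x)
  }

-- Let D′ be a paired dominating set of G·ℓ, S its part in G and P its part on the path. Only
-- the attachment vertex v sees the path, so S dominates every vertex of G other than v, and the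
-- matching pairs S within itself except that v may be paired with a path vertex. If it is, then
-- |P| ≥ 1: remove v and, when v has a neighbour u outside S, add back v paired with u. Otherwise S
-- is matched within itself; if S does not dominate v, then v is dominated by a path vertex whose
-- partner is again on the path, so |P| ≥ 2 and v may be added together with any neighbour. Each
-- time the result has at most |S| + |P| vertices.
module Submission where

open import Defs
open import Data.Nat using (ℕ; _≤_)
open import Data.Fin using (Fin)

open import Data.Bool using (true)
import Data.Bool as Bool
open import Data.Empty using (⊥-elim)
open import Data.Fin using (zero; suc; _↑ˡ_; _↑ʳ_; splitAt; _≟_)
open import Data.Fin.Properties using (splitAt⁻¹-↑ˡ; splitAt⁻¹-↑ʳ; splitAt-↑ˡ; splitAt-↑ʳ; any?)
open import Data.Fin.Subset using (Subset; inside; outside; _∈_; _∉_; _⊆_; ∣_∣; _∪_; _─_; _-_; ⁅_⁆)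
open import Data.Fin.Subset.Properties
  using (_∈?_; p⊆p∪q; x∈p∪q⁺; x∈p∪q⁻; x∈⁅x⁆; x∈⁅y⁆⇒x≡y; ∣⁅x⁆∣≡1; p─q⊆p; ∣p─q∣≤∣p∣; x∈p∧x≢y⇒x∈p-y; x∈p⇒∣p-x∣<∣p∣)
open import Data.Nat using (suc; _+_; z≤n; s≤s)
open import Data.Nat.Properties using (module ≤-Reasoning; ≤-trans; ≤-reflexive; +-suc; m≤n⇒m≤1+n; m≤m+n; +-monoʳ-≤; +-mono-≤)
open import Data.Product using (Σ; ∃; _×_; _,_; proj₁; proj₂)
open import Data.Sum using (_⊎_; inj₁; inj₂; [_,_]′)
open import Data.Vec using ([]; _∷_; _++_; take; drop; here; there)
open import Data.Vec.Properties using (take++drop≡id)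
open import Relation.Binary.PropositionalEquality using (_≡_; _≢_; refl; sym; trans; cong; cong₂; subst)
open import Relation.Nullary using (¬_; Dec; yes; no; ¬?; _×-dec_; _⊎-dec_)

↑ˡ-or-↑ʳ : ∀ m {k} (x : Fin (m + k)) → (∃ λ a → a ↑ˡ k ≡ x) ⊎ (∃ λ i → m ↑ʳ i ≡ x)
↑ˡ-or-↑ʳ m x with splitAt m x in eq
... | inj₁ a = inj₁ (a , splitAt⁻¹-↑ˡ eq)
... | inj₂ i = inj₂ (i , splitAt⁻¹-↑ʳ eq)

↑ˡ≢↑ʳ : ∀ {m k} (a : Fin m) (i : Fin k) → a ↑ˡ k ≢ m ↑ʳ i
↑ˡ≢↑ʳ {m} {k} a i e with trans (sym (splitAt-↑ˡ m a k)) (trans (cong (splitAt m) e) (splitAt-↑ʳ m k i))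
... | ()

∣p++q∣≡∣p∣+∣q∣ : ∀ {m k} (p : Subset m) (q : Subset k) → ∣ p ++ q ∣ ≡ ∣ p ∣ + ∣ q ∣
∣p++q∣≡∣p∣+∣q∣ []            q = refl
∣p++q∣≡∣p∣+∣q∣ (inside  ∷ p) q = cong suc (∣p++q∣≡∣p∣+∣q∣ p q)
∣p++q∣≡∣p∣+∣q∣ (outside ∷ p) q = ∣p++q∣≡∣p∣+∣q∣ p q

∈-++ˡ⁺ : ∀ {m k} {p : Subset m} {q : Subset k} {x} → x ∈ p → x ↑ˡ k ∈ p ++ q
∈-++ˡ⁺ here      = here
∈-++ˡ⁺ (there h) = there (∈-++ˡ⁺ h)

∈-++ˡ⁻ : ∀ {m k} (p : Subset m) {q : Subset k} {x} → x ↑ˡ k ∈ p ++ q → x ∈ p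
∈-++ˡ⁻ (s ∷ p) {x = zero}  here      = here
∈-++ˡ⁻ (s ∷ p) {x = suc x} (there h) = there (∈-++ˡ⁻ p h)

∈-++ʳ⁻ : ∀ {m k} (p : Subset m) {q : Subset k} {i} → m ↑ʳ i ∈ p ++ q → i ∈ q
∈-++ʳ⁻ []      h         = h
∈-++ʳ⁻ (s ∷ p) (there h) = ∈-++ʳ⁻ p h

x∈p─q⇒x∉q : ∀ {m} (p q : Subset m) {x} → x ∈ p ─ q → x ∉ q
x∈p─q⇒x∉q (s ∷ p) (outside ∷ q) here      ()
x∈p─q⇒x∉q (s ∷ p) (t ∷ q)       (there h) (there h') = x∈p─q⇒x∉q p q h h'

x∈p-y⇒x≢y : ∀ {m} (p : Subset m) {x y} → x ∈ p - y → x ≢ y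
x∈p-y⇒x≢y p {y = y} h refl = x∈p─q⇒x∉q p ⁅ y ⁆ h (x∈⁅x⁆ y)

∣p∪q∣≤∣p∣+∣q∣ : ∀ {m} (p q : Subset m) → ∣ p ∪ q ∣ ≤ ∣ p ∣ + ∣ q ∣
∣p∪q∣≤∣p∣+∣q∣ []            []            = z≤n
∣p∪q∣≤∣p∣+∣q∣ (inside  ∷ p) (inside  ∷ q) = s≤s (≤-trans (m≤n⇒m≤1+n (∣p∪q∣≤∣p∣+∣q∣ p q)) (≤-reflexive (sym (+-suc _ _))))
∣p∪q∣≤∣p∣+∣q∣ (inside  ∷ p) (outside ∷ q) = s≤s (∣p∪q∣≤∣p∣+∣q∣ p q)
∣p∪q∣≤∣p∣+∣q∣ (outside ∷ p) (inside  ∷ q) = ≤-trans (s≤s (∣p∪q∣≤∣p∣+∣q∣ p q)) (≤-reflexive (sym (+-suc _ _)))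
∣p∪q∣≤∣p∣+∣q∣ (outside ∷ p) (outside ∷ q) = ∣p∪q∣≤∣p∣+∣q∣ p q

∣p∪⁅x⁆∪⁅y⁆∣≤∣p∣+2 : ∀ {m} (p : Subset m) x y → ∣ p ∪ ⁅ x ⁆ ∪ ⁅ y ⁆ ∣ ≤ ∣ p ∣ + 2
∣p∪⁅x⁆∪⁅y⁆∣≤∣p∣+2 p x y = ≤-trans (∣p∪q∣≤∣p∣+∣q∣ p _) (+-monoʳ-≤ ∣ p ∣
  (≤-trans (∣p∪q∣≤∣p∣+∣q∣ ⁅ x ⁆ ⁅ y ⁆) (≤-reflexive (cong₂ _+_ (∣⁅x⁆∣≡1 x) (∣⁅x⁆∣≡1 y)))))

x∈p⇒1≤∣p∣ : ∀ {m} {p : Subset m} {x} → x ∈ p → 1 ≤ ∣ p ∣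
x∈p⇒1≤∣p∣ x∈p = ≤-trans (s≤s z≤n) (x∈p⇒∣p-x∣<∣p∣ x∈p)

x∈p∧y∈p∧x≢y⇒2≤∣p∣ : ∀ {m} {p : Subset m} {x y} → x ∈ p → y ∈ p → x ≢ y → 2 ≤ ∣ p ∣
x∈p∧y∈p∧x≢y⇒2≤∣p∣ x∈p y∈p x≢y = ≤-trans (s≤s (x∈p⇒1≤∣p∣ (x∈p∧x≢y⇒x∈p-y x∈p x≢y))) (x∈p⇒∣p-x∣<∣p∣ y∈p)

module _ (G : Graph) where

  adj⇒≢ : ∀ {x y} → Adj G x y ≡ true → x ≢ y
  adj⇒≢ {x} adj refl with trans (sym adj) (irrefl G x)
  ... | ()

  Dominated : Subset (n G) → Fin (n G) → Set
  Dominated D x = x ∈ D ⊎ ∃ λ y → y ∈ D × Adj G x y ≡ true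

  dominated? : ∀ D x → Dec (Dominated D x)
  dominated? D x = (x ∈? D) ⊎-dec any? (λ y → (y ∈? D) ×-dec (Adj G x y Bool.≟ true))

  dominated-⊆ : ∀ {D D′ x} → D ⊆ D′ → Dominated D x → Dominated D′ x
  dominated-⊆ D⊆D′ (inj₁ x∈D)            = inj₁ (D⊆D′ x∈D)
  dominated-⊆ D⊆D′ (inj₂ (y , y∈D , xy)) = inj₂ (y , D⊆D′ y∈D , xy)

  DominatingExcept : Subset (n G) → Fin (n G) → Set
  DominatingExcept D v = ∀ w → w ≢ v → Dominated D w

  dominatingExcept⇒dominating : ∀ {D v} → DominatingExcept D v → Dominated D v → Dominating G D
  dominatingExcept⇒dominating {v = v} dom dv w with w ≟ v
  ... | yes refl = dv
  ... | no w≢v   = dom w w≢v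

  -- A vertex that only v dominated is a neighbour of v, hence still in D - v.
  dominating-remove : ∀ {D v} → DominatingExcept D v → (∀ u → Adj G v u ≡ true → u ∈ D) →
                      (∃ λ u → Adj G v u ≡ true) → Dominating G (D - v)
  dominating-remove {D} {v} dom nbrs⊆D (u , vu) w with w ≟ v
  ... | yes refl = inj₂ (u , x∈p∧x≢y⇒x∈p-y (nbrs⊆D u vu) (λ u≡v → adj⇒≢ vu (sym u≡v)) , vu)
  ... | no w≢v with dom w w≢v
  ... | inj₁ w∈D = inj₁ (x∈p∧x≢y⇒x∈p-y w∈D w≢v)
  ... | inj₂ (y , y∈D , wy) with y ≟ v
  ...   | yes refl = inj₁ (x∈p∧x≢y⇒x∈p-y (nbrs⊆D w (trans (symm G v w) wy)) w≢v)
  ...   | no y≢v   = inj₂ (y , x∈p∧x≢y⇒x∈p-y y∈D y≢v , wy)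

  inducedPerfectMatching-addEdge : ∀ {D u w} → InducedPerfectMatching G D → u ∉ D → w ∉ D →
                                   Adj G u w ≡ true → InducedPerfectMatching G (D ∪ ⁅ u ⁆ ∪ ⁅ w ⁆)
  inducedPerfectMatching-addEdge {D} {u} {w} (q , q-matches) u∉D w∉D uw = q′ , q′-matches
    where
    u≢w : u ≢ w
    u≢w = adj⇒≢ uw

    q′ : Fin (n G) → Fin (n G)
    q′ x with x ≟ u | x ≟ w
    ... | yes _ | _     = w
    ... | no _  | yes _ = u
    ... | no _  | no _  = q x

    q′u : q′ u ≡ w
    q′u with u ≟ u
    ... | yes _   = refl
    ... | no u≢u  = ⊥-elim (u≢u refl)

    q′w : q′ w ≡ u
    q′w with w ≟ u | w ≟ w
    ... | yes w≡u | _       = ⊥-elim (u≢w (sym w≡u))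
    ... | no _    | yes _   = refl
    ... | no _    | no w≢w  = ⊥-elim (w≢w refl)

    q′-on-D : ∀ {x} → x ∈ D → q′ x ≡ q x
    q′-on-D {x} x∈D with x ≟ u | x ≟ w
    ... | yes refl | _        = ⊥-elim (u∉D x∈D)
    ... | no _     | yes refl = ⊥-elim (w∉D x∈D)
    ... | no _     | no _     = refl

    u∈D′ : u ∈ D ∪ ⁅ u ⁆ ∪ ⁅ w ⁆
    u∈D′ = x∈p∪q⁺ (inj₂ (x∈p∪q⁺ (inj₁ (x∈⁅x⁆ u))))

    w∈D′ : w ∈ D ∪ ⁅ u ⁆ ∪ ⁅ w ⁆
    w∈D′ = x∈p∪q⁺ (inj₂ (x∈p∪q⁺ (inj₂ (x∈⁅x⁆ w))))

    q′-matches : ∀ x → x ∈ D ∪ ⁅ u ⁆ ∪ ⁅ w ⁆ →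
                 (q′ x ∈ D ∪ ⁅ u ⁆ ∪ ⁅ w ⁆) × (Adj G x (q′ x) ≡ true) × (q′ (q′ x) ≡ x)
    q′-matches x x∈D′ with x∈p∪q⁻ D _ x∈D′
    ... | inj₁ x∈D
      rewrite q′-on-D x∈D | q′-on-D (proj₁ (q-matches x x∈D))
      = let (qx∈D , adj , invol) = q-matches x x∈D in x∈p∪q⁺ (inj₁ qx∈D) , adj , invol
    ... | inj₂ x∈⁅u⁆∪⁅w⁆ with x∈p∪q⁻ ⁅ u ⁆ ⁅ w ⁆ x∈⁅u⁆∪⁅w⁆
    ...   | inj₁ x∈⁅u⁆ rewrite x∈⁅y⁆⇒x≡y u x∈⁅u⁆ | q′u | q′w = w∈D′ , uw , refl
    ...   | inj₂ x∈⁅w⁆ rewrite x∈⁅y⁆⇒x≡y w x∈⁅w⁆ | q′w | q′u = u∈D′ , trans (symm G w u) uw , refl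

module AttachPath (G : Graph) (ℓ : ℕ) (v : Fin (n G)) where

  N : ℕ
  N = n G

  H : Graph
  H = attachPath G ℓ v

  adj-↑ˡ : ∀ a b → Adj H (a ↑ˡ ℓ) (b ↑ˡ ℓ) ≡ Adj G a b
  adj-↑ˡ a b rewrite splitAt-↑ˡ N a ℓ | splitAt-↑ˡ N b ℓ = refl

  adj-↑ˡ-↑ʳ : ∀ a i → Adj H (a ↑ˡ ℓ) (N ↑ʳ i) ≡ true → a ≡ v
  adj-↑ˡ-↑ʳ a i adj rewrite splitAt-↑ˡ N a ℓ | splitAt-↑ʳ N ℓ i with a ≟ v
  ... | yes a≡v = a≡v
  adj-↑ˡ-↑ʳ a i () | no _

  adj-↑ʳ-↑ˡ : ∀ i a → Adj H (N ↑ʳ i) (a ↑ˡ ℓ) ≡ true → a ≡ v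
  adj-↑ʳ-↑ˡ i a adj = adj-↑ˡ-↑ʳ a i (trans (symm H (a ↑ˡ ℓ) (N ↑ʳ i)) adj)

  module Restrict (noIsolated : NoIsolated G) (S : Subset N) (P : Subset ℓ)
                  (dom′ : Dominating H (S ++ P)) (matching : InducedPerfectMatching H (S ++ P)) where

    p′ : Fin (N + ℓ) → Fin (N + ℓ)
    p′ = proj₁ matching

    partner-∈ : ∀ {x} → x ∈ S ++ P → p′ x ∈ S ++ P
    partner-∈ x∈D′ = proj₁ (proj₂ matching _ x∈D′)

    partner-adj : ∀ {x} → x ∈ S ++ P → Adj H x (p′ x) ≡ true
    partner-adj x∈D′ = proj₁ (proj₂ (proj₂ matching _ x∈D′))

    partner-invol : ∀ {x} → x ∈ S ++ P → p′ (p′ x) ≡ x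
    partner-invol x∈D′ = proj₂ (proj₂ (proj₂ matching _ x∈D′))

    graphPartner-∈ : ∀ {a b} → a ∈ S → p′ (a ↑ˡ ℓ) ≡ b ↑ˡ ℓ → b ∈ S
    graphPartner-∈ a∈S e = ∈-++ˡ⁻ S (subst (_∈ S ++ P) e (partner-∈ (∈-++ˡ⁺ a∈S)))

    pathPartner⇒≡v : ∀ {a i} → a ∈ S → p′ (a ↑ˡ ℓ) ≡ N ↑ʳ i → a ≡ v
    pathPartner⇒≡v {a} a∈S e =
      adj-↑ˡ-↑ʳ a _ (subst (λ y → Adj H (a ↑ˡ ℓ) y ≡ true) e (partner-adj (∈-++ˡ⁺ a∈S)))

    dominatingExcept : DominatingExcept G S v
    dominatingExcept w w≢v with dom′ (w ↑ˡ ℓ)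
    ... | inj₁ w∈D′ = inj₁ (∈-++ˡ⁻ S w∈D′)
    ... | inj₂ (y , y∈D′ , wy) with ↑ˡ-or-↑ʳ N y
    ...   | inj₁ (b , refl) = inj₂ (b , ∈-++ˡ⁻ S y∈D′ , trans (sym (adj-↑ˡ w b)) wy)
    ...   | inj₂ (i , refl) = ⊥-elim (w≢v (adj-↑ˡ-↑ʳ w i wy))

    ClosedUnderMatching : Subset N → Set
    ClosedUnderMatching T = ∀ {a} → a ∈ T → ∃ λ b → p′ (a ↑ˡ ℓ) ≡ b ↑ˡ ℓ × b ∈ T

    -- On vertices matched inside G this is the partner; elsewhere the value is junk.
    graphPartner : Fin N → Fin N
    graphPartner a = [ (λ b → b) , (λ _ → a) ]′ (splitAt N (p′ (a ↑ˡ ℓ)))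

    graphPartner-≡ : ∀ {a b} → p′ (a ↑ˡ ℓ) ≡ b ↑ˡ ℓ → graphPartner a ≡ b
    graphPartner-≡ {a} {b} e =
      trans (cong (λ y → [ (λ b → b) , (λ _ → a) ]′ (splitAt N y)) e)
            (cong [ (λ b → b) , (λ _ → a) ]′ (splitAt-↑ˡ N b ℓ))

    closed⇒inducedPerfectMatching : ∀ {T} → T ⊆ S → ClosedUnderMatching T → InducedPerfectMatching G T
    closed⇒inducedPerfectMatching {T} T⊆S closed = graphPartner , matches
      where
      matches : ∀ a → a ∈ T → (graphPartner a ∈ T) × (Adj G a (graphPartner a) ≡ true) ×
                              (graphPartner (graphPartner a) ≡ a)
      matches a a∈T with closed a∈T
      ... | b , e , b∈T rewrite graphPartner-≡ e = b∈T , ab , graphPartner-≡ ba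
        where
        a∈D′ : a ↑ˡ ℓ ∈ S ++ P
        a∈D′ = ∈-++ˡ⁺ (T⊆S a∈T)
        ab : Adj G a b ≡ true
        ab = trans (sym (adj-↑ˡ a b)) (subst (λ y → Adj H (a ↑ˡ ℓ) y ≡ true) e (partner-adj a∈D′))
        ba : p′ (b ↑ˡ ℓ) ≡ a ↑ˡ ℓ
        ba = trans (cong p′ (sym e)) (partner-invol a∈D′)

    closedUnderMatching : (∀ {i} → v ∈ S → p′ (v ↑ˡ ℓ) ≢ N ↑ʳ i) → ClosedUnderMatching S
    closedUnderMatching v-not-pathMatched {a} a∈S with ↑ˡ-or-↑ʳ N (p′ (a ↑ˡ ℓ))
    ... | inj₁ (b , e) = b , sym e , graphPartner-∈ a∈S (sym e)
    ... | inj₂ (i , e) with pathPartner⇒≡v a∈S (sym e)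
    ...   | refl = ⊥-elim (v-not-pathMatched a∈S (sym e))

    undominated⇒2≤∣P∣ : ¬ Dominated G S v → 2 ≤ ∣ P ∣
    undominated⇒2≤∣P∣ ¬dv with dom′ (v ↑ˡ ℓ)
    ... | inj₁ v∈D′ = ⊥-elim (¬dv (inj₁ (∈-++ˡ⁻ S v∈D′)))
    ... | inj₂ (y , y∈D′ , vy) with ↑ˡ-or-↑ʳ N y
    ...   | inj₁ (b , refl) = ⊥-elim (¬dv (inj₂ (b , ∈-++ˡ⁻ S y∈D′ , trans (sym (adj-↑ˡ v b)) vy)))
    ...   | inj₂ (j , refl) with ↑ˡ-or-↑ʳ N (p′ (N ↑ʳ j))
    ...     | inj₁ (b , e) = ⊥-elim (¬dv (inj₁ (subst (_∈ S) b≡v (∈-++ˡ⁻ S (subst (_∈ S ++ P) (sym e) (partner-∈ y∈D′))))))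
      where
      b≡v : b ≡ v
      b≡v = adj-↑ʳ-↑ˡ j b (subst (λ z → Adj H (N ↑ʳ j) z ≡ true) (sym e) (partner-adj y∈D′))
    ...     | inj₂ (k , e) = x∈p∧y∈p∧x≢y⇒2≤∣p∣ (∈-++ʳ⁻ S y∈D′) (∈-++ʳ⁻ S (subst (_∈ S ++ P) (sym e) (partner-∈ y∈D′))) j≢k
      where
      j≢k : j ≢ k
      j≢k j≡k = adj⇒≢ H (subst (λ z → Adj H (N ↑ʳ j) z ≡ true) (sym e) (partner-adj y∈D′)) (cong (N ↑ʳ_) j≡k)

    dominating-⊇ : ∀ {D} → S ⊆ D → v ∈ D → Dominating G D
    dominating-⊇ S⊆D v∈D =
      dominatingExcept⇒dominating G (λ w w≢v → dominated-⊆ G S⊆D (dominatingExcept w w≢v)) (inj₁ v∈D)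

    Restriction : Set
    Restriction = Σ (Subset N) λ D → PairedDominating G D × ∣ D ∣ ≤ ∣ S ∣ + ∣ P ∣

    restrict-closed : ClosedUnderMatching S → Restriction
    restrict-closed closed with dominated? G S v
    ... | yes dv = S , (dominatingExcept⇒dominating G dominatingExcept dv , matchingS) , m≤m+n ∣ S ∣ ∣ P ∣
      where
      matchingS = closed⇒inducedPerfectMatching (λ a∈S → a∈S) closed
    ... | no ¬dv = S ∪ ⁅ v ⁆ ∪ ⁅ u ⁆ , (dominating , matching′) ,
                   ≤-trans (∣p∪⁅x⁆∪⁅y⁆∣≤∣p∣+2 S v u) (+-monoʳ-≤ ∣ S ∣ (undominated⇒2≤∣P∣ ¬dv))
      where
      u = proj₁ (noIsolated v)
      vu = proj₂ (noIsolated v)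
      matching′ = inducedPerfectMatching-addEdge G (closed⇒inducedPerfectMatching (λ a∈S → a∈S) closed)
                    (λ v∈S → ¬dv (inj₁ v∈S)) (λ u∈S → ¬dv (inj₂ (u , u∈S , vu))) vu
      dominating = dominating-⊇ (p⊆p∪q _) (x∈p∪q⁺ (inj₂ (x∈p∪q⁺ (inj₁ (x∈⁅x⁆ v)))))

    restrict-pathMatched : ∀ {i} → v ∈ S → p′ (v ↑ˡ ℓ) ≡ N ↑ʳ i → Restriction
    restrict-pathMatched {i} v∈S e = go (any? (λ u → (Adj G v u Bool.≟ true) ×-dec ¬? (u ∈? S)))
      where
      S-v⊆S : S - v ⊆ S
      S-v⊆S = p─q⊆p S ⁅ v ⁆

      1≤∣P∣ : 1 ≤ ∣ P ∣
      1≤∣P∣ = x∈p⇒1≤∣p∣ (∈-++ʳ⁻ S (subst (_∈ S ++ P) e (partner-∈ (∈-++ˡ⁺ v∈S))))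

      closed : ClosedUnderMatching (S - v)
      closed {a} a∈S-v with ↑ˡ-or-↑ʳ N (p′ (a ↑ˡ ℓ))
      ... | inj₂ (j , e′) = ⊥-elim (x∈p-y⇒x≢y S a∈S-v (pathPartner⇒≡v (S-v⊆S a∈S-v) (sym e′)))
      ... | inj₁ (b , e′) = b , sym e′ , x∈p∧x≢y⇒x∈p-y (graphPartner-∈ (S-v⊆S a∈S-v) (sym e′)) b≢v
        where
        b≢v : b ≢ v
        b≢v refl = ↑ˡ≢↑ʳ a i (trans (sym (trans (cong p′ e′) (partner-invol (∈-++ˡ⁺ (S-v⊆S a∈S-v))))) e)

      matchingS-v : InducedPerfectMatching G (S - v)
      matchingS-v = closed⇒inducedPerfectMatching S-v⊆S closed

      go : Dec (∃ λ u → Adj G v u ≡ true × u ∉ S) → Restriction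
      go (yes (u , vu , u∉S)) = D , (dominating-⊇ S⊆D (x∈p∪q⁺ (inj₂ (x∈p∪q⁺ (inj₁ (x∈⁅x⁆ v))))) , matching′) , size
        where
        D = (S - v) ∪ ⁅ v ⁆ ∪ ⁅ u ⁆
        matching′ = inducedPerfectMatching-addEdge G matchingS-v
                      (λ v∈S-v → x∈p-y⇒x≢y S v∈S-v refl) (λ u∈S-v → u∉S (S-v⊆S u∈S-v)) vu
        S⊆D : S ⊆ D
        S⊆D {x} x∈S with x ≟ v
        ... | yes refl = x∈p∪q⁺ (inj₂ (x∈p∪q⁺ (inj₁ (x∈⁅x⁆ v))))
        ... | no x≢v   = x∈p∪q⁺ (inj₁ (x∈p∧x≢y⇒x∈p-y x∈S x≢v))
        size : ∣ D ∣ ≤ ∣ S ∣ + ∣ P ∣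
        size = ≤-trans (∣p∪⁅x⁆∪⁅y⁆∣≤∣p∣+2 (S - v) v u)
                 (≤-trans (≤-reflexive (+-suc ∣ S - v ∣ 1)) (+-mono-≤ (x∈p⇒∣p-x∣<∣p∣ v∈S) 1≤∣P∣))
      go (no ∄u) = S - v , (dominating-remove G dominatingExcept nbrs⊆S (noIsolated v) , matchingS-v) ,
                   ≤-trans (∣p─q∣≤∣p∣ S ⁅ v ⁆) (m≤m+n ∣ S ∣ ∣ P ∣)
        where
        nbrs⊆S : ∀ u → Adj G v u ≡ true → u ∈ S
        nbrs⊆S u vu with u ∈? S
        ... | yes u∈S = u∈S
        ... | no u∉S  = ⊥-elim (∄u (u , vu , u∉S))

    restrict : Restriction
    restrict with v ∈? S
    ... | no v∉S = restrict-closed (closedUnderMatching (λ v∈S _ → v∉S v∈S))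
    ... | yes v∈S with ↑ˡ-or-↑ʳ N (p′ (v ↑ˡ ℓ))
    ...   | inj₂ (i , e) = restrict-pathMatched v∈S (sym e)
    ...   | inj₁ (b , e) = restrict-closed (closedUnderMatching (λ _ e′ → ↑ˡ≢↑ʳ b _ (trans e e′)))

mainTheorem4 : (G : Graph) → VertexTransitive G → NoIsolated G →
    (ℓ : ℕ) (v : Fin (n G)) (a b : ℕ) →
    IsPairedDomNumber (attachPath G ℓ v) a → IsPairedDomNumber G b → b ≤ a
mainTheorem4 G _ noIsolated ℓ v a b ((D′ , (dom′ , matching) , ∣D′∣≡a) , _) (_ , minimal) =
  begin
    b                 ≤⟨ minimal D pd ⟩
    ∣ D ∣             ≤⟨ ∣D∣≤ ⟩
    ∣ S ∣ + ∣ P ∣     ≡⟨ ∣p++q∣≡∣p∣+∣q∣ S P ⟨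
    ∣ S ++ P ∣        ≡⟨ cong ∣_∣ (take++drop≡id (n G) D′) ⟩
    ∣ D′ ∣            ≡⟨ ∣D′∣≡a ⟩
    a                 ∎
  where
  open ≤-Reasoning
  H = attachPath G ℓ v
  S = take (n G) D′
  P = drop (n G) D′
  D′≡S++P = sym (take++drop≡id (n G) D′)
  restriction = AttachPath.Restrict.restrict G ℓ v noIsolated S P
                  (subst (Dominating H) D′≡S++P dom′) (subst (InducedPerfectMatching H) D′≡S++P matching)
  D = proj₁ restriction
  pd = proj₁ (proj₂ restriction)
  ∣D∣≤ = proj₂ (proj₂ restriction)
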